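{- Let $\mathcal{C}$ be a set of $3$-dimensional subspaces of $V=\mathbb{F}_2^6$ such that $\dim(E\cap E')\le 1$ for all distinct $E,E'\in\mathcal{C}$. If $\#\mathcal{C}\ge 73$, then $\mathcal{C}$ contains a $9$-configuration, i.e. there is a $1$-dimensional subspace $P$ of $V$ contained in (at least, hence exactly) $9$ members of $\mathcal{C}$.
   Context: The degree of a point (1-dimensional subspace) $P$ of $V$ is $r(P)=\#\{E\in\mathcal{C}:P\subseteq E\}$; for such $\mathcal{C}$ one always has $r(P)\le 9$. A $9$-configuration is a subset of $\mathcal{C}$ consisting of $9$ members passing through a common point $P$. -}

module Defs where

open import Data.Bool using (Bool; true; false; _xor_; _∧_)
open import Data.Vec using (Vec; replicate; zipWith; map)
open import Data.Nat using (ℕ)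
open import Data.Fin using (Fin)
open import Data.Product using (Σ; _×_; ∃)
open import Relation.Binary.PropositionalEquality using (_≡_; _≢_)
open import Relation.Nullary using (¬_)

-- The ambient space V = F₂⁶, with F₂ = Bool (addition = xor, multiplication = ∧).
V : Set
V = Vec Bool 6

0V : V
0V = replicate 6 false

_⊕_ : V → V → V
u ⊕ v = zipWith _xor_ u v

_·_ : Bool → V → V
a · v = map (a ∧_) v

SubsetV : Set
SubsetV = V → Bool

_∈_ : V → SubsetV → Set
x ∈ E = E x ≡ true

_≐_ : SubsetV → SubsetV → Set
E ≐ E' = ∀ x → E x ≡ E' x

LinIndep2 : V → V → Set
LinIndep2 u v = ∀ a b → (a · u) ⊕ (b · v) ≡ 0V → (a ≡ false) × (b ≡ false)

LinIndep3 : V → V → V → Set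
LinIndep3 u v w = ∀ a b c → ((a · u) ⊕ (b · v)) ⊕ (c · w) ≡ 0V →
  (a ≡ false) × (b ≡ false) × (c ≡ false)

Is3Subspace : SubsetV → Set
Is3Subspace E = Σ V λ u → Σ V λ v → Σ V λ w →
  LinIndep3 u v w ×
  (∀ x → x ∈ E → Σ Bool λ a → Σ Bool λ b → Σ Bool λ c → x ≡ ((a · u) ⊕ (b · v)) ⊕ (c · w)) ×
  (∀ a b c → (((a · u) ⊕ (b · v)) ⊕ (c · w)) ∈ E)

IntersectDimLe1 : SubsetV → SubsetV → Set
IntersectDimLe1 E E' = ∀ u v → u ∈ E → u ∈ E' → v ∈ E → v ∈ E' → ¬ LinIndep2 u v

-- A 1-dimensional subspace P = span{p} (p ≠ 0) is contained in E iff p ∈ E.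

-- A 3-dimensional subspace of F₂⁶ contains 7 nonzero vectors, so double counting
-- the incident pairs (E, p) with E ∈ 𝒞 and p ≠ 0 gives
--   Σ_p r(p) ≥ 7 · #𝒞 ≥ 7 · 73 = 511 > 504 = 8 · 63,
-- and some of the 63 points lies on at least 9 members of 𝒞.  The hypotheses on
-- distinctness and on dim (E ∩ E′) are only needed for the upper bound r(p) ≤ 9.
module Submission where

open import Defs
open import Data.Nat using (ℕ; _≤_)
open import Data.Fin using (Fin)
open import Data.Product using (Σ; _×_)
open import Relation.Binary.PropositionalEquality using (_≡_; _≢_)
open import Relation.Nullary using (¬_)
open import Function.Definitions using (Injective)

open import Algebra.Bundles using (CommutativeRing; CommutativeMonoid)
open import Data.Bool using (Bool; true; false; _xor_; _∧_; if_then_else_)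
open import Data.Bool.Properties using (_≟_; xor-same; ∧-distribʳ-xor; xor-∧-commutativeRing)
open import Data.Empty using (⊥-elim)
open import Data.Fin using (zero; suc; inject≤)
open import Data.Fin.Patterns using (0F; 1F; 2F; 3F; 4F; 5F; 6F)
open import Data.Fin.Properties using (injective⇒≤; inject≤-injective)
import Data.List as List
open import Data.List using (List; []; _∷_; _++_; length; filter; lookup; allFin)
open import Data.List.Membership.Propositional using (find) renaming (_∈_ to _∈ₗ_)
open import Data.List.Membership.Propositional.Properties
  using (∈-filter⁺; ∈-filter⁻; ∈-map⁺; ∈-++⁺ˡ; ∈-++⁺ʳ; ∈-lookup)
open import Data.List.Properties using (length-tabulate; map-cong)
import Data.List.Relation.Unary.All as All
open import Data.List.Relation.Unary.All using (All; []; _∷_)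
open import Data.List.Relation.Unary.All.Properties using (¬Any⇒All¬)
open import Data.List.Relation.Unary.AllPairs using (_∷_)
import Data.List.Relation.Unary.Any as Any
open import Data.List.Relation.Unary.Any using (Any; here; any?)
open import Data.List.Relation.Unary.Any.Properties using (lookup-index)
open import Data.List.Relation.Unary.Unique.Propositional using (Unique)
import Data.List.Relation.Unary.Unique.Propositional.Properties as Unique
open import Data.Nat using (zero; suc; _+_; _*_; z≤n; _≤?_)
open import Data.Nat.ListAction using (sum)
open import Data.Nat.Properties
  using (≤-pred; ≰⇒>; *-suc; *-zeroʳ; +-mono-≤; *-monoʳ-≤; +-commutativeSemigroup; module ≤-Reasoning)
open import Data.Product using (_,_; proj₁; proj₂)
open import Data.Vec using (Vec; []; _∷_; zipWith; replicate)
import Data.Vec as Vec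
open import Data.Vec.Properties using (≡-dec)
open import Function using (_∘_; id)
open import Relation.Binary.PropositionalEquality
  using (refl; sym; trans; cong; cong₂; subst; module ≡-Reasoning)
open import Relation.Nullary using (Dec; does; yes; no; ¬?; from-no)
open import Relation.Unary using (Pred; Decidable)

open import Algebra.Properties.CommutativeSemigroup
  (CommutativeMonoid.commutativeSemigroup (CommutativeRing.+-commutativeMonoid xor-∧-commutativeRing))
  using () renaming (interchange to xor-interchange)
open import Algebra.Properties.CommutativeSemigroup +-commutativeSemigroup
  using () renaming (interchange to +-interchange)

zipWith-xor-interchange : ∀ {n} (u v u′ v′ : Vec Bool n) →
  zipWith _xor_ (zipWith _xor_ u v) (zipWith _xor_ u′ v′) ≡
  zipWith _xor_ (zipWith _xor_ u u′) (zipWith _xor_ v v′)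
zipWith-xor-interchange []      []      []       []       = refl
zipWith-xor-interchange (a ∷ u) (b ∷ v) (a′ ∷ u′) (b′ ∷ v′) =
  cong₂ _∷_ (xor-interchange a b a′ b′) (zipWith-xor-interchange u v u′ v′)

map-∧-distribʳ-xor : ∀ {n} a b (u : Vec Bool n) →
  Vec.map ((a xor b) ∧_) u ≡ zipWith _xor_ (Vec.map (a ∧_) u) (Vec.map (b ∧_) u)
map-∧-distribʳ-xor a b []      = refl
map-∧-distribʳ-xor a b (x ∷ u) = cong₂ _∷_ (∧-distribʳ-xor x a b) (map-∧-distribʳ-xor a b u)

zipWith-xor-self : ∀ {n} (u : Vec Bool n) → zipWith _xor_ u u ≡ replicate n false
zipWith-xor-self []      = refl
zipWith-xor-self (x ∷ u) = cong₂ _∷_ (xor-same x) (zipWith-xor-self u)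

xor≡false⇒≡ : ∀ a b → a xor b ≡ false → a ≡ b
xor≡false⇒≡ false false _ = refl
xor≡false⇒≡ true  true  _ = refl

Coeffs : Set
Coeffs = Bool × Bool × Bool

0ᶜ : Coeffs
0ᶜ = false , false , false

_⊕ᶜ_ : Coeffs → Coeffs → Coeffs
(a , b , c) ⊕ᶜ (a′ , b′ , c′) = a xor a′ , b xor b′ , c xor c′

⊕ᶜ≡0ᶜ⇒≡ : ∀ s t → s ⊕ᶜ t ≡ 0ᶜ → s ≡ t
⊕ᶜ≡0ᶜ⇒≡ (a , b , c) (a′ , b′ , c′) eq =
  cong₂ _,_ (xor≡false⇒≡ a a′ (cong proj₁ eq))
    (cong₂ _,_ (xor≡false⇒≡ b b′ (cong (proj₁ ∘ proj₂) eq)) (xor≡false⇒≡ c c′ (cong (proj₂ ∘ proj₂) eq)))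

combination : V → V → V → Coeffs → V
combination u v w (a , b , c) = ((a · u) ⊕ (b · v)) ⊕ (c · w)

combination-⊕ : ∀ u v w s t →
  combination u v w s ⊕ combination u v w t ≡ combination u v w (s ⊕ᶜ t)
combination-⊕ u v w (a , b , c) (a′ , b′ , c′) = begin
  (((a · u) ⊕ (b · v)) ⊕ (c · w)) ⊕ (((a′ · u) ⊕ (b′ · v)) ⊕ (c′ · w))
    ≡⟨ zipWith-xor-interchange _ _ _ _ ⟩
  (((a · u) ⊕ (b · v)) ⊕ ((a′ · u) ⊕ (b′ · v))) ⊕ ((c · w) ⊕ (c′ · w))
    ≡⟨ cong (_⊕ ((c · w) ⊕ (c′ · w))) (zipWith-xor-interchange _ _ _ _) ⟩
  (((a · u) ⊕ (a′ · u)) ⊕ ((b · v) ⊕ (b′ · v))) ⊕ ((c · w) ⊕ (c′ · w))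
    ≡⟨ sym (cong₂ _⊕_ (cong₂ _⊕_ (map-∧-distribʳ-xor a a′ u) (map-∧-distribʳ-xor b b′ v))
                      (map-∧-distribʳ-xor c c′ w)) ⟩
  (((a xor a′) · u) ⊕ ((b xor b′) · v)) ⊕ ((c xor c′) · w)
    ∎
  where open ≡-Reasoning

combination≡0V⇒≡0ᶜ : ∀ {u v w} → LinIndep3 u v w → ∀ t → combination u v w t ≡ 0V → t ≡ 0ᶜ
combination≡0V⇒≡0ᶜ indep (a , b , c) eq with indep a b c eq
... | refl , refl , refl = refl

combination-injective : ∀ {u v w} → LinIndep3 u v w → Injective _≡_ _≡_ (combination u v w)
combination-injective {u} {v} {w} indep {s} {t} eq =
  ⊕ᶜ≡0ᶜ⇒≡ s t (combination≡0V⇒≡0ᶜ indep (s ⊕ᶜ t) (begin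
    combination u v w (s ⊕ᶜ t)                      ≡⟨ sym (combination-⊕ u v w s t) ⟩
    combination u v w s ⊕ combination u v w t       ≡⟨ cong (_⊕ combination u v w t) eq ⟩
    combination u v w t ⊕ combination u v w t       ≡⟨ zipWith-xor-self (combination u v w t) ⟩
    0V                                              ∎))
  where open ≡-Reasoning

nonzeroCoeffs : Fin 7 → Coeffs
nonzeroCoeffs 0F = false , false , true
nonzeroCoeffs 1F = false , true  , false
nonzeroCoeffs 2F = false , true  , true
nonzeroCoeffs 3F = true  , false , false
nonzeroCoeffs 4F = true  , false , true
nonzeroCoeffs 5F = true  , true  , false
nonzeroCoeffs 6F = true  , true  , true

nonzeroCoeffs≢0ᶜ : ∀ k → nonzeroCoeffs k ≢ 0ᶜ
nonzeroCoeffs≢0ᶜ 0F ()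
nonzeroCoeffs≢0ᶜ 1F ()
nonzeroCoeffs≢0ᶜ 2F ()
nonzeroCoeffs≢0ᶜ 3F ()
nonzeroCoeffs≢0ᶜ 4F ()
nonzeroCoeffs≢0ᶜ 5F ()
nonzeroCoeffs≢0ᶜ 6F ()

nonzeroCoeffs-injective : Injective _≡_ _≡_ nonzeroCoeffs
nonzeroCoeffs-injective {i} {j} eq = begin
  i                          ≡⟨ sym (index-nonzeroCoeffs i) ⟩
  index (nonzeroCoeffs i)    ≡⟨ cong index eq ⟩
  index (nonzeroCoeffs j)    ≡⟨ index-nonzeroCoeffs j ⟩
  j                          ∎
  where
  open ≡-Reasoning
  index : Coeffs → Fin 7
  index (false , false , false) = 0F
  index (false , false , true)  = 0F
  index (false , true  , false) = 1F
  index (false , true  , true)  = 2F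
  index (true  , false , false) = 3F
  index (true  , false , true)  = 4F
  index (true  , true  , false) = 5F
  index (true  , true  , true)  = 6F
  index-nonzeroCoeffs : ∀ k → index (nonzeroCoeffs k) ≡ k
  index-nonzeroCoeffs 0F = refl
  index-nonzeroCoeffs 1F = refl
  index-nonzeroCoeffs 2F = refl
  index-nonzeroCoeffs 3F = refl
  index-nonzeroCoeffs 4F = refl
  index-nonzeroCoeffs 5F = refl
  index-nonzeroCoeffs 6F = refl

lookup-injective : ∀ {A : Set} {xs : List A} → Unique xs → Injective _≡_ _≡_ (lookup xs)
lookup-injective (_     ∷ _)    {zero}  {zero}  _  = refl
lookup-injective (x∉xs ∷ _)    {zero}  {suc j} eq = ⊥-elim (All.lookup x∉xs (∈-lookup j) eq)
lookup-injective (x∉xs ∷ _)    {suc i} {zero}  eq = ⊥-elim (All.lookup x∉xs (∈-lookup i) (sym eq))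
lookup-injective (_     ∷ uniq) {suc i} {suc j} eq = cong suc (lookup-injective uniq eq)

injection⇒≤-length : ∀ {A : Set} {m} {xs : List A} {f : Fin m → A} →
  Injective _≡_ _≡_ f → (∀ k → f k ∈ₗ xs) → m ≤ length xs
injection⇒≤-length {xs = xs} {f} f-injective f∈xs = injective⇒≤ index-injective
  where
  index-injective : Injective _≡_ _≡_ (λ k → Any.index (f∈xs k))
  index-injective {i} {j} eq = f-injective (begin
    f i                               ≡⟨ lookup-index (f∈xs i) ⟩
    lookup xs (Any.index (f∈xs i))    ≡⟨ cong (lookup xs) eq ⟩
    lookup xs (Any.index (f∈xs j))    ≡⟨ lookup-index (f∈xs j) ⟨
    f j                               ∎)
    where open ≡-Reasoning

≤-length⇒injection : ∀ {A : Set} {m} {xs : List A} → Unique xs → m ≤ length xs →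
  Σ (Fin m → A) λ f → Injective _≡_ _≡_ f × (∀ k → f k ∈ₗ xs)
≤-length⇒injection {xs = xs} uniq m≤∣xs∣ =
  (λ k → lookup xs (inject≤ k m≤∣xs∣)) ,
  (λ eq → inject≤-injective m≤∣xs∣ m≤∣xs∣ _ _ (lookup-injective uniq eq)) ,
  (λ k → ∈-lookup (inject≤ k m≤∣xs∣))

indicator : ∀ {P : Set} → Dec P → ℕ
indicator P? = if does P? then 1 else 0

length-filter : ∀ {A : Set} {P : Pred A _} (P? : Decidable P) (xs : List A) →
  length (filter P? xs) ≡ sum (List.map (indicator ∘ P?) xs)
length-filter P? []       = refl
length-filter P? (x ∷ xs) with does (P? x)
... | true  = cong suc (length-filter P? xs)
... | false = length-filter P? xs

sum-map-+ : ∀ {A : Set} (f g : A → ℕ) (xs : List A) →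
  sum (List.map (λ x → f x + g x) xs) ≡ sum (List.map f xs) + sum (List.map g xs)
sum-map-+ f g []       = refl
sum-map-+ f g (x ∷ xs) = trans (cong (f x + g x +_) (sum-map-+ f g xs))
  (+-interchange (f x) (g x) (sum (List.map f xs)) (sum (List.map g xs)))

sum-map-0 : ∀ {A : Set} (xs : List A) → sum (List.map (λ _ → 0) xs) ≡ 0
sum-map-0 []       = refl
sum-map-0 (_ ∷ xs) = sum-map-0 xs

sum-map-comm : ∀ {A B : Set} (f : A → B → ℕ) (xs : List A) (ys : List B) →
  sum (List.map (λ x → sum (List.map (f x) ys)) xs) ≡
  sum (List.map (λ y → sum (List.map (λ x → f x y) xs)) ys)
sum-map-comm f []       ys = sym (sum-map-0 ys)
sum-map-comm f (x ∷ xs) ys = trans (cong (sum (List.map (f x) ys) +_) (sum-map-comm f xs ys))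
  (sym (sum-map-+ (f x) (λ y → sum (List.map (λ x′ → f x′ y) xs)) ys))

double-counting : ∀ {A B : Set} {R : A → B → Set} (R? : ∀ x y → Dec (R x y)) (xs : List A) (ys : List B) →
  sum (List.map (λ x → length (filter (R? x) ys)) xs) ≡
  sum (List.map (λ y → length (filter (λ x → R? x y) xs)) ys)
double-counting R? xs ys = begin
  sum (List.map (λ x → length (filter (R? x) ys)) xs)
    ≡⟨ cong sum (map-cong (λ x → length-filter (R? x) ys) xs) ⟩
  sum (List.map (λ x → sum (List.map (λ y → indicator (R? x y)) ys)) xs)
    ≡⟨ sum-map-comm (λ x y → indicator (R? x y)) xs ys ⟩
  sum (List.map (λ y → sum (List.map (λ x → indicator (R? x y)) xs)) ys)
    ≡⟨ cong sum (map-cong (λ y → length-filter (λ x → R? x y) xs) ys) ⟨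
  sum (List.map (λ y → length (filter (λ x → R? x y) xs)) ys)
    ∎
  where open ≡-Reasoning

sum-map-≤ : ∀ {A : Set} (f : A → ℕ) k (xs : List A) →
  All (λ x → f x ≤ k) xs → sum (List.map f xs) ≤ k * length xs
sum-map-≤ f k []       []           = z≤n
sum-map-≤ f k (x ∷ xs) (fx≤k ∷ f≤k) =
  subst (sum (List.map f (x ∷ xs)) ≤_) (sym (*-suc k (length xs))) (+-mono-≤ fx≤k (sum-map-≤ f k xs f≤k))

sum-map-≥ : ∀ {A : Set} (f : A → ℕ) k (xs : List A) →
  (∀ x → k ≤ f x) → k * length xs ≤ sum (List.map f xs)
sum-map-≥ f k []       k≤f = subst (_≤ 0) (sym (*-zeroʳ k)) z≤n
sum-map-≥ f k (x ∷ xs) k≤f =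
  subst (_≤ sum (List.map f (x ∷ xs))) (sym (*-suc k (length xs))) (+-mono-≤ (k≤f x) (sum-map-≥ f k xs k≤f))

allVectors : ∀ n → List (Vec Bool n)
allVectors zero    = [] ∷ []
allVectors (suc n) = List.map (true ∷_) (allVectors n) ++ List.map (false ∷_) (allVectors n)

∈-allVectors : ∀ {n} (v : Vec Bool n) → v ∈ₗ allVectors n
∈-allVectors []               = here refl
∈-allVectors {suc n} (true ∷ v)  = ∈-++⁺ˡ (∈-map⁺ (true ∷_) (∈-allVectors v))
∈-allVectors {suc n} (false ∷ v) = ∈-++⁺ʳ (List.map (true ∷_) (allVectors n)) (∈-map⁺ (false ∷_) (∈-allVectors v))

_≟V_ : (u v : V) → Dec (u ≡ v)
_≟V_ = ≡-dec _≟_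

nonzeroVectors : List V
nonzeroVectors = filter (λ v → ¬? (v ≟V 0V)) (allVectors 6)

∈-nonzeroVectors⁺ : ∀ {v} → v ≢ 0V → v ∈ₗ nonzeroVectors
∈-nonzeroVectors⁺ {v} = ∈-filter⁺ (λ v → ¬? (v ≟V 0V)) (∈-allVectors v)

∈-nonzeroVectors⁻ : ∀ {v} → v ∈ₗ nonzeroVectors → v ≢ 0V
∈-nonzeroVectors⁻ = proj₂ ∘ ∈-filter⁻ (λ v → ¬? (v ≟V 0V)) {xs = allVectors 6}

pointsOf : SubsetV → List V
pointsOf E = filter (λ p → E p ≟ true) nonzeroVectors

Is3Subspace⇒7≤∣pointsOf∣ : ∀ {E} → Is3Subspace E → 7 ≤ length (pointsOf E)
Is3Subspace⇒7≤∣pointsOf∣ {E} (u , v , w , indep , _ , E-closed) =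
  injection⇒≤-length point-injective point∈pointsOf
  where
  point : Fin 7 → V
  point = combination u v w ∘ nonzeroCoeffs
  point-injective : Injective _≡_ _≡_ point
  point-injective = nonzeroCoeffs-injective ∘ combination-injective indep
  point∈pointsOf : ∀ k → point k ∈ₗ pointsOf E
  point∈pointsOf k =
    ∈-filter⁺ (λ p → E p ≟ true)
      (∈-nonzeroVectors⁺ (nonzeroCoeffs≢0ᶜ k ∘ combination≡0V⇒≡0ᶜ indep (nonzeroCoeffs k)))
      (E-closed _ _ _)

planesThrough : ∀ {n} → (Fin n → SubsetV) → V → List (Fin n)
planesThrough {n} C p = filter (λ i → C i p ≟ true) (allFin n)

some-point-on-9-planes : ∀ n (C : Fin n → SubsetV) →
  (∀ i → 7 ≤ length (pointsOf (C i))) → 73 ≤ n →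
  Any (λ p → 9 ≤ length (planesThrough C p)) nonzeroVectors
some-point-on-9-planes n C 7≤∣C∣ 73≤n with any? (λ p → 9 ≤? length (planesThrough C p)) nonzeroVectors
... | yes rich = rich
... | no ¬rich = ⊥-elim (from-no (511 ≤? 504) 511≤504)
  where
  open ≤-Reasoning
  ∣planesThrough∣≤8 : All (λ p → length (planesThrough C p) ≤ 8) nonzeroVectors
  ∣planesThrough∣≤8 = All.map (≤-pred ∘ ≰⇒>) (¬Any⇒All¬ nonzeroVectors ¬rich)
  511≤504 : 511 ≤ 504
  511≤504 = begin
    7 * 73                                                              ≤⟨ *-monoʳ-≤ 7 73≤n ⟩
    7 * n                                                               ≡⟨ cong (7 *_) (length-tabulate {n = n} id) ⟨
    7 * length (allFin n)                                               ≤⟨ sum-map-≥ _ 7 (allFin n) 7≤∣C∣ ⟩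
    sum (List.map (λ i → length (pointsOf (C i))) (allFin n))           ≡⟨ double-counting (λ i p → C i p ≟ true) (allFin n) nonzeroVectors ⟩
    sum (List.map (λ p → length (planesThrough C p)) nonzeroVectors)    ≤⟨ sum-map-≤ _ 8 nonzeroVectors ∣planesThrough∣≤8 ⟩
    8 * length nonzeroVectors                                           ≡⟨⟩
    504                                                                 ∎

lemma7 : (n : ℕ) → (C : Fin n → SubsetV) →
    (∀ i → Is3Subspace (C i)) →
    (∀ i j → i ≢ j → ¬ (C i ≐ C j)) →
    (∀ i j → i ≢ j → IntersectDimLe1 (C i) (C j)) →
    73 ≤ n →
    Σ V λ p → (p ≢ 0V) ×
      Σ (Fin 9 → Fin n) λ f → Injective _≡_ _≡_ f × (∀ k → p ∈ C (f k))
lemma7 n C C-3subspaces _ _ 73≤n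
  with p , p∈nonzeroVectors , 9≤r[p] ← find (some-point-on-9-planes n C (Is3Subspace⇒7≤∣pointsOf∣ ∘ C-3subspaces) 73≤n)
  with f , f-injective , f∈planesThrough ← ≤-length⇒injection (Unique.filter⁺ _ (Unique.allFin⁺ n)) 9≤r[p]
  = p , ∈-nonzeroVectors⁻ p∈nonzeroVectors , f , f-injective ,
    (proj₂ ∘ ∈-filter⁻ (λ i → C i p ≟ true) {xs = allFin n} ∘ f∈planesThrough)
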